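{- Let $n \geq 1$ and let $\varphi$ be a Boolean formula in Precise Conjunctive Normal Form whose variables are among a set of $n$ variables. If $\varphi$ has more than $g(n) = \sum_{i=1}^{n} 2^{i}\binom{n}{i} - \sum_{i=1}^{n}\binom{n}{i} - \sum_{i=0}^{n-1}\binom{n-1}{i}$ $(=3^n-2^n-2^{n-1})$ clauses, then $\varphi$ has either a unique satisfying truth assignment (to these $n$ variables) or no satisfying truth assignment.
   Context: A literal is a variable $x$ or its complement $\sim x$. A clause is a (nonempty) disjunction of literals; a formula in conjunctive normal form is a conjunction of clauses. A Boolean formula is in Precise Conjunctive Normal Form (PCNF) if it is a conjunction of pairwise distinct clauses, where each clause is a disjunction of pairwise distinct literals and no clause contains both a variable and its complement. Clauses are identified as sets of literals. A truth assignment satisfies the formula if it makes every clause true. -}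

module Defs where

open import Data.Nat using (ℕ; zero; suc; _+_; _*_; _∸_; _^_)
open import Data.Nat.Combinatorics using (_C_)
open import Data.Fin using (Fin)
open import Data.Bool using (Bool; true; false; not)
open import Data.Product using (_×_; _,_)
open import Data.List using (List; []; _∷_; length; map; upTo)
open import Data.Nat.ListAction using (sum)
open import Data.List.Relation.Unary.All using (All)
open import Data.List.Relation.Unary.Any using (Any)
open import Data.List.Relation.Unary.AllPairs using (AllPairs)
open import Data.List.Membership.Propositional using (_∈_)
open import Data.List.Relation.Binary.Subset.Propositional using (_⊆_)
open import Relation.Binary.PropositionalEquality using (_≡_; _≢_)
open import Relation.Nullary using (¬_)

-- A literal over variables Fin n: a variable together with a polarity
-- (true = x, false = ∼x).
record Literal (n : ℕ) : Set where
  constructor lit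
  field
    var : Fin n
    pos : Bool
open Literal public

complement : ∀ {n} → Literal n → Literal n
complement (lit x b) = lit x (not b)

-- A clause is represented by a list of literals (identified as a set).
Clause : ℕ → Set
Clause n = List (Literal n)

Formula : ℕ → Set
Formula n = List (Clause n)

SameSet : ∀ {n} → Clause n → Clause n → Set
SameSet c d = (c ⊆ d) × (d ⊆ c)

PreciseClause : ∀ {n} → Clause n → Set
PreciseClause c =
  ¬ (c ≡ []) ×
  AllPairs _≢_ c ×
  (∀ l → l ∈ c → ¬ (complement l ∈ c))

IsPCNF : ∀ {n} → Formula n → Set
IsPCNF φ = All PreciseClause φ × AllPairs (λ c d → ¬ SameSet c d) φ

Assignment : ℕ → Set
Assignment n = Fin n → Bool

litTrue : ∀ {n} → Assignment n → Literal n → Set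
litTrue σ (lit x b) = σ x ≡ b

Satisfies : ∀ {n} → Assignment n → Formula n → Set
Satisfies σ φ = All (λ c → Any (litTrue σ) c) φ

-- Summation over i from a to b (inclusive).
sumFromTo : ℕ → ℕ → (ℕ → ℕ) → ℕ
sumFromTo a b f = sum (map (λ k → f (a + k)) (upTo (suc b ∸ a)))

g : ℕ → ℕ
g n = sumFromTo 1 n (λ i → 2 ^ i * (n C i))
      ∸ sumFromTo 1 n (λ i → n C i)
      ∸ sumFromTo 0 (n ∸ 1) (λ i → (n ∸ 1) C i)

-- A clause without complementary literals is determined by its sign pattern, a word
-- over {nothing, just true, just false} of length n, so the clauses of a PCNF formula
-- have pairwise distinct patterns. If σ and τ both satisfy φ, the pattern of every
-- clause is hit by both of them. Splitting patterns by their first entry, exactly 2ⁿ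
-- of the 3ⁿ patterns miss a given assignment, and if σ ≠ τ at least 3·2ⁿ⁻¹ miss σ or τ.
-- So φ has at most 3ⁿ − 3·2ⁿ⁻¹ clauses, which is g(n) by the binomial theorem.
module Submission where

open import Defs
open import Data.Nat using (ℕ; zero; suc; _+_; _*_; _∸_; _^_; _≤_; _≥_; _>_; z≤n; s≤s; s≤s⁻¹)
open import Data.Nat.Properties
open import Data.Nat.Combinatorics using (_C_)
open import Data.Nat.Tactic.RingSolver using (solve-∀)
open import Data.Nat.ListAction using (sum)
open import Data.Bool as Bool using (Bool; true; false; _∧_; if_then_else_)
open import Data.Bool.Properties using (¬-not; ∧-conicalˡ)
open import Data.Maybe using (Maybe; just; nothing)
open import Data.Fin as Fin using (Fin; toℕ)
open import Data.Vec using (Vec; []; _∷_; lookup; tabulate)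
open import Data.Vec.Properties using (lookup∘tabulate)
open import Data.List using (List; []; _∷_; _++_; [_]; length; map; applyUpTo)
open import Data.List.Properties using (length-++; length-map; length-++-sucʳ)
open import Data.List.Relation.Unary.All as All using (All; []; _∷_)
open import Data.List.Relation.Unary.Any using (Any; here; there)
open import Data.List.Relation.Unary.AllPairs as AllPairs using (AllPairs; []; _∷_)
import Data.List.Relation.Unary.AllPairs.Properties as AllPairs
import Data.List.Relation.Unary.All.Properties as All
open import Data.List.Relation.Unary.Unique.Propositional using (Unique)
open import Data.List.Membership.Propositional using (_∈_; find)
open import Data.List.Membership.Propositional.Properties using (∈-∃++; ∈-++⁻; ∈-++⁺ˡ; ∈-++⁺ʳ; ∈-map⁺)
open import Data.List.Relation.Binary.Subset.Propositional using (_⊆_)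
open import Data.Product using (_×_; _,_; proj₂)
open import Data.Sum using (inj₁; inj₂)
open import Function using (_∘_; id)
open import Relation.Nullary using (¬_; yes; no; contradiction)
open import Relation.Binary.PropositionalEquality using (_≡_; _≢_; refl; sym; trans; cong; cong₂; subst; module ≡-Reasoning)
open import Algebra.Properties.Monoid.Sum +-0-monoid using (sum-syntax; sum⁺-syntax; sum-cong-≗)
open import Algebra.Properties.Monoid.Mult +-0-monoid using () renaming (_×_ to _×ᵐ_)
open import Algebra.Properties.Semiring.Exp +-*-semiring using () renaming (_^_ to _^ˢ_)
import Algebra.Properties.CommutativeSemiring.Binomial +-*-commutativeSemiring as Binomial

module _ {a} {A : Set a} where

  ∈-++-∷⁻ : ∀ {x y : A} us {vs} → y ∈ us ++ x ∷ vs → x ≢ y → y ∈ us ++ vs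
  ∈-++-∷⁻ us y∈ x≢y with ∈-++⁻ us y∈
  ... | inj₁ y∈us         = ∈-++⁺ˡ y∈us
  ... | inj₂ (here y≡x)   = contradiction (sym y≡x) x≢y
  ... | inj₂ (there y∈vs) = ∈-++⁺ʳ us y∈vs

  Unique-⊆⇒length≤ : ∀ {xs ys : List A} → Unique xs → xs ⊆ ys → length xs ≤ length ys
  Unique-⊆⇒length≤ [] _ = z≤n
  Unique-⊆⇒length≤ {x ∷ xs} (x∉xs ∷ xs!) x∷xs⊆ys with ∈-∃++ (x∷xs⊆ys (here refl))
  ... | us , vs , refl = begin
    suc (length xs)          ≤⟨ s≤s (Unique-⊆⇒length≤ xs! xs⊆us++vs) ⟩
    suc (length (us ++ vs))  ≡⟨ sym (length-++-sucʳ us x vs) ⟩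
    length (us ++ x ∷ vs)    ∎
    where
    open ≤-Reasoning
    xs⊆us++vs : xs ⊆ us ++ vs
    xs⊆us++vs y∈xs = ∈-++-∷⁻ us (x∷xs⊆ys (there y∈xs)) (All.lookup x∉xs y∈xs)

  AllPairs-map-All : ∀ {p r s} {P : A → Set p} {R : A → A → Set r} {S : A → A → Set s} →
    (∀ {x y} → P x → P y → R x y → S x y) →
    ∀ {xs} → All P xs → AllPairs R xs → AllPairs S xs
  AllPairs-map-All f [] [] = []
  AllPairs-map-All f (px ∷ pxs) (rx ∷ rxs) =
    All.zipWith (λ (py , rxy) → f px py rxy) (pxs , rx) ∷ AllPairs-map-All f pxs rxs

3*q≡q+[q+q] : ∀ q → 3 * q ≡ q + (q + q)
3*q≡q+[q+q] q = cong (λ u → q + (q + u)) (+-identityʳ q)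

×ᵐ≡* : ∀ n x → n ×ᵐ x ≡ n * x
×ᵐ≡* zero    x = refl
×ᵐ≡* (suc n) x = cong (x +_) (×ᵐ≡* n x)

^ˢ≡^ : ∀ x n → x ^ˢ n ≡ x ^ n
^ˢ≡^ x zero    = refl
^ˢ≡^ x (suc n) = cong (x *_) (^ˢ≡^ x n)

binomial-sum : ∀ x n → ∑[ k ≤ n ] (x ^ toℕ k * (n C toℕ k)) ≡ (x + 1) ^ n
binomial-sum x n = begin
  ∑[ k ≤ n ] (x ^ toℕ k * (n C toℕ k))  ≡⟨ sum-cong-≗ {suc n} (term ∘ toℕ) ⟩
  Binomial.binomialExpansion x 1 n      ≡⟨ Binomial.theorem n x 1 ⟨
  (x + 1) ^ˢ n                          ≡⟨ ^ˢ≡^ (x + 1) n ⟩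
  (x + 1) ^ n                           ∎
  where
  open ≡-Reasoning
  term : ∀ i → x ^ i * (n C i) ≡ (n C i) ×ᵐ (x ^ˢ i * 1 ^ˢ (n ∸ i))
  term i = begin
    x ^ i * (n C i)                      ≡⟨ *-comm (x ^ i) (n C i) ⟩
    (n C i) * x ^ i                      ≡⟨ cong ((n C i) *_) (*-identityʳ (x ^ i)) ⟨
    (n C i) * (x ^ i * 1)                ≡⟨ cong (λ u → (n C i) * (x ^ i * u)) (^-zeroˡ (n ∸ i)) ⟨
    (n C i) * (x ^ i * 1 ^ (n ∸ i))      ≡⟨ cong ((n C i) *_) (cong₂ _*_ (^ˢ≡^ x i) (^ˢ≡^ 1 (n ∸ i))) ⟨
    (n C i) * (x ^ˢ i * 1 ^ˢ (n ∸ i))    ≡⟨ ×ᵐ≡* (n C i) _ ⟨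
    (n C i) ×ᵐ (x ^ˢ i * 1 ^ˢ (n ∸ i))   ∎

∑-binomial-coefficients : ∀ n → ∑[ k ≤ n ] (n C toℕ k) ≡ 2 ^ n
∑-binomial-coefficients n =
  trans (sum-cong-≗ {suc n} λ k → sym (1^k*nCk≡nCk (toℕ k))) (binomial-sum 1 n)
  where
  1^k*nCk≡nCk : ∀ k → 1 ^ k * (n C k) ≡ n C k
  1^k*nCk≡nCk k = trans (cong (_* (n C k)) (^-zeroˡ k)) (*-identityˡ (n C k))

sum-map-applyUpTo : ∀ (f h : ℕ → ℕ) n → sum (map f (applyUpTo h n)) ≡ ∑[ i < n ] f (h (toℕ i))
sum-map-applyUpTo f h zero    = refl
sum-map-applyUpTo f h (suc n) = cong (f (h 0) +_) (sum-map-applyUpTo f (h ∘ suc) n)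

sumFromTo-∑ : ∀ a b f → sumFromTo a b f ≡ ∑[ i < suc b ∸ a ] f (a + toℕ i)
sumFromTo-∑ a b f = sum-map-applyUpTo (λ k → f (a + k)) id (suc b ∸ a)

g-bound : ∀ {c} m → c + 3 * 2 ^ m ≤ 3 ^ suc m → c ≤ g (suc m)
g-bound {c} m c+3·2ᵐ≤3ⁿ = m+n≤o⇒m≤o∸n c (m+n≤o⇒m≤o∸n (c + S₃) (s≤s⁻¹ (begin
  suc (c + S₃ + S₂)      ≡⟨ sym (+-suc (c + S₃) S₂) ⟩
  c + S₃ + suc S₂        ≡⟨ cong₂ (λ u v → c + u + v) S₃≡2ᵐ suc-S₂≡2ⁿ ⟩
  c + 2 ^ m + 2 * 2 ^ m  ≡⟨ +-assoc c (2 ^ m) (2 * 2 ^ m) ⟩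
  c + 3 * 2 ^ m          ≤⟨ c+3·2ᵐ≤3ⁿ ⟩
  3 ^ n                  ≡⟨ sym suc-S₁≡3ⁿ ⟩
  suc S₁                 ∎)))
  where
  open ≤-Reasoning
  n = suc m
  S₁ = sumFromTo 1 n (λ i → 2 ^ i * (n C i))
  S₂ = sumFromTo 1 n (n C_)
  S₃ = sumFromTo 0 m (m C_)
  suc-S₁≡3ⁿ : suc S₁ ≡ 3 ^ n
  suc-S₁≡3ⁿ = trans (cong suc (sumFromTo-∑ 1 n (λ i → 2 ^ i * (n C i)))) (binomial-sum 2 n)
  suc-S₂≡2ⁿ : suc S₂ ≡ 2 ^ n
  suc-S₂≡2ⁿ = trans (cong suc (sumFromTo-∑ 1 n (n C_))) (∑-binomial-coefficients n)
  S₃≡2ᵐ : S₃ ≡ 2 ^ m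
  S₃≡2ᵐ = trans (sumFromTo-∑ 0 m (m C_)) (∑-binomial-coefficients m)

-- Entry i is just b if the literal (i , b) occurs and nothing if variable i does not.
Pattern : ℕ → Set
Pattern = Vec (Maybe Bool)

count : ∀ m → (Pattern m → Bool) → ℕ
count zero    P = if P [] then 1 else 0
count (suc m) P =
  count m (P ∘ (nothing ∷_)) + (count m (P ∘ (just true ∷_)) + count m (P ∘ (just false ∷_)))

satisfying : ∀ m → (Pattern m → Bool) → List (Pattern m)
satisfying zero    P = if P [] then [ [] ] else []
satisfying (suc m) P =
  map (nothing ∷_)    (satisfying m (P ∘ (nothing ∷_))) ++
  map (just true ∷_)  (satisfying m (P ∘ (just true ∷_))) ++
  map (just false ∷_) (satisfying m (P ∘ (just false ∷_)))

length-satisfying : ∀ m P → length (satisfying m P) ≡ count m P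
length-satisfying zero P with P []
... | true  = refl
... | false = refl
length-satisfying (suc m) P = begin
  length (xs₀ ++ xs₁ ++ xs₂)              ≡⟨ length-++ xs₀ ⟩
  length xs₀ + length (xs₁ ++ xs₂)        ≡⟨ cong (length xs₀ +_) (length-++ xs₁) ⟩
  length xs₀ + (length xs₁ + length xs₂)  ≡⟨ cong₂ _+_ (length-part nothing)
                                               (cong₂ _+_ (length-part (just true)) (length-part (just false))) ⟩
  count (suc m) P                         ∎
  where
  open ≡-Reasoning
  part : Maybe Bool → List (Pattern (suc m))
  part e = map (e ∷_) (satisfying m (P ∘ (e ∷_)))
  xs₀ = part nothing
  xs₁ = part (just true)
  xs₂ = part (just false)
  length-part : ∀ e → length (part e) ≡ count m (P ∘ (e ∷_))
  length-part e = trans (length-map (e ∷_) (satisfying m (P ∘ (e ∷_))))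
                        (length-satisfying m (P ∘ (e ∷_)))

∈-satisfying : ∀ {m} P {v : Pattern m} → P v ≡ true → v ∈ satisfying m P
∈-satisfying P {[]} Pv rewrite Pv = here refl
∈-satisfying P {nothing ∷ v} Pv =
  ∈-++⁺ˡ (∈-map⁺ (nothing ∷_) (∈-satisfying (P ∘ (nothing ∷_)) Pv))
∈-satisfying P {just true ∷ v} Pv =
  ∈-++⁺ʳ (map (nothing ∷_) (satisfying _ (P ∘ (nothing ∷_))))
    (∈-++⁺ˡ (∈-map⁺ (just true ∷_) (∈-satisfying (P ∘ (just true ∷_)) Pv)))
∈-satisfying P {just false ∷ v} Pv =
  ∈-++⁺ʳ (map (nothing ∷_) (satisfying _ (P ∘ (nothing ∷_))))
    (∈-++⁺ʳ (map (just true ∷_) (satisfying _ (P ∘ (just true ∷_))))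
      (∈-map⁺ (just false ∷_) (∈-satisfying (P ∘ (just false ∷_)) Pv)))

Unique⇒length≤count : ∀ {m} P {vs : List (Pattern m)} → Unique vs → All (λ v → P v ≡ true) vs →
  length vs ≤ count m P
Unique⇒length≤count {m} P vs! Pvs = ≤-trans
  (Unique-⊆⇒length≤ vs! (λ v∈vs → ∈-satisfying P (All.lookup Pvs v∈vs)))
  (≤-reflexive (length-satisfying m P))

count-suc-≤ : ∀ m P {p q r s t} → s ≡ p + (q + r) →
  count m (P ∘ (nothing ∷_)) + p ≤ t →
  count m (P ∘ (just true ∷_)) + q ≤ t →
  count m (P ∘ (just false ∷_)) + r ≤ t →
  count (suc m) P + s ≤ 3 * t
count-suc-≤ m P {p} {q} {r} {t = t} refl a+p≤t b+q≤t c+r≤t = begin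
  a + (b + c) + (p + (q + r))  ≡⟨ interchange a b c p q r ⟩
  a + p + (b + q + (c + r))    ≤⟨ +-mono-≤ a+p≤t (+-mono-≤ b+q≤t c+r≤t) ⟩
  t + (t + t)                  ≡⟨ 3*q≡q+[q+q] t ⟨
  3 * t                        ∎
  where
  open ≤-Reasoning
  a = count m (P ∘ (nothing ∷_))
  b = count m (P ∘ (just true ∷_))
  c = count m (P ∘ (just false ∷_))
  interchange : ∀ a b c p q r → a + (b + c) + (p + (q + r)) ≡ a + p + (b + q + (c + r))
  interchange = solve-∀

count-mono : ∀ m {P Q : Pattern m → Bool} → (∀ v → P v ≡ true → Q v ≡ true) →
  count m P ≤ count m Q
count-mono zero {P} {Q} P⇒Q with P [] in Pv
... | false = z≤n
... | true  rewrite P⇒Q [] Pv = ≤-refl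
count-mono (suc m) P⇒Q =
  +-mono-≤ (count-mono m (P⇒Q ∘ (nothing ∷_)))
    (+-mono-≤ (count-mono m (P⇒Q ∘ (just true ∷_))) (count-mono m (P⇒Q ∘ (just false ∷_))))

count-const-true : ∀ m → count m (λ _ → true) ≡ 3 ^ m
count-const-true zero    = refl
count-const-true (suc m) rewrite count-const-true m = sym (3*q≡q+[q+q] (3 ^ m))

count-const-true-≤ : ∀ m → count m (λ _ → true) + 0 ≤ 3 ^ m
count-const-true-≤ m = ≤-reflexive (trans (+-identityʳ _) (count-const-true m))

hits : ∀ {m} → Vec Bool m → Pattern m → Bool
hits []          []               = false
hits (_ ∷ ρ)     (nothing ∷ v)    = hits ρ v
hits (true ∷ _)  (just true ∷ _)  = true
hits (false ∷ _) (just false ∷ _) = true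
hits (_ ∷ ρ)     (just _ ∷ v)     = hits ρ v

hits-lookup : ∀ {m} (ρ : Vec Bool m) v i → lookup v i ≡ just (lookup ρ i) → hits ρ v ≡ true
hits-lookup (true ∷ ρ)  (just true ∷ v)  Fin.zero eq = refl
hits-lookup (false ∷ ρ) (just false ∷ v) Fin.zero eq = refl
hits-lookup (r ∷ ρ) (e ∷ v) (Fin.suc i) eq = hits-∷ r e (hits-lookup ρ v i eq)
  where
  hits-∷ : ∀ r e {v} → hits ρ v ≡ true → hits (r ∷ ρ) (e ∷ v) ≡ true
  hits-∷ r           nothing      h = h
  hits-∷ true        (just true)  h = refl
  hits-∷ false       (just false) h = refl
  hits-∷ true        (just false) h = h
  hits-∷ false       (just true)  h = h

-- The patterns missing ρ are those with entries in {nothing, just (not ρᵢ)}.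
count-hits : ∀ m (ρ : Vec Bool m) → count m (hits ρ) + 2 ^ m ≤ 3 ^ m
count-hits zero    []      = ≤-refl
count-hits (suc m) (true ∷ ρ)  =
  count-suc-≤ m (hits (true ∷ ρ)) (cong (2 ^ m +_) (+-identityʳ (2 ^ m)))
    (count-hits m ρ) (count-const-true-≤ m) (count-hits m ρ)
count-hits (suc m) (false ∷ ρ) =
  count-suc-≤ m (hits (false ∷ ρ)) refl
    (count-hits m ρ) (count-hits m ρ) (count-const-true-≤ m)

count-≤-hits : ∀ m ρ {P : Pattern m → Bool} → (∀ v → P v ≡ true → hits ρ v ≡ true) →
  count m P + 2 ^ m ≤ 3 ^ m
count-≤-hits m ρ P⇒hits = ≤-trans (+-monoˡ-≤ (2 ^ m) (count-mono m P⇒hits)) (count-hits m ρ)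

hitsBoth : ∀ {m} → Vec Bool m → Vec Bool m → Pattern m → Bool
hitsBoth σ τ v = hits σ v ∧ hits τ v

-- Once σ and τ differ in the first entry, each slice is bounded by count-hits for σ or τ.
count-hitsBoth : ∀ m (σ τ : Vec Bool (suc m)) → σ ≢ τ →
  count (suc m) (hitsBoth σ τ) + 3 * 2 ^ m ≤ 3 ^ suc m
count-hitsBoth zero (true ∷ [])  (true ∷ [])  σ≢τ = contradiction refl σ≢τ
count-hitsBoth zero (false ∷ []) (false ∷ []) σ≢τ = contradiction refl σ≢τ
count-hitsBoth (suc m) (true ∷ σ) (true ∷ τ) σ≢τ =
  count-suc-≤ (suc m) (hitsBoth (true ∷ σ) (true ∷ τ)) (3*2q≡3q+[0+3q] (2 ^ m)) ih (count-const-true-≤ (suc m)) ih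
  where
  ih = count-hitsBoth m σ τ (σ≢τ ∘ cong (true ∷_))
  3*2q≡3q+[0+3q] : ∀ q → 3 * (2 * q) ≡ 3 * q + (0 + 3 * q)
  3*2q≡3q+[0+3q] = solve-∀
count-hitsBoth (suc m) (false ∷ σ) (false ∷ τ) σ≢τ =
  count-suc-≤ (suc m) (hitsBoth (false ∷ σ) (false ∷ τ)) (3*2q≡3q+[3q+0] (2 ^ m)) ih ih (count-const-true-≤ (suc m))
  where
  ih = count-hitsBoth m σ τ (σ≢τ ∘ cong (false ∷_))
  3*2q≡3q+[3q+0] : ∀ q → 3 * (2 * q) ≡ 3 * q + (3 * q + 0)
  3*2q≡3q+[3q+0] = solve-∀
count-hitsBoth m (true ∷ σ) (false ∷ τ) _ =
  count-suc-≤ m (hitsBoth (true ∷ σ) (false ∷ τ)) (3*q≡q+[q+q] (2 ^ m))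
    (count-≤-hits m σ (λ v → ∧-conicalˡ (hits σ v) (hits τ v)))
    (count-hits m τ)
    (count-≤-hits m σ (λ v → ∧-conicalˡ (hits σ v) true))
count-hitsBoth m (false ∷ σ) (true ∷ τ) _ =
  count-suc-≤ m (hitsBoth (false ∷ σ) (true ∷ τ)) (3*q≡q+[q+q] (2 ^ m))
    (count-≤-hits m σ (λ v → ∧-conicalˡ (hits σ v) (hits τ v)))
    (count-≤-hits m σ (λ v → ∧-conicalˡ (hits σ v) true))
    (count-hits m τ)

Consistent : ∀ {n} → Clause n → Set
Consistent c = ∀ l → l ∈ c → ¬ complement l ∈ c

polarity : ∀ {n} → Clause n → Fin n → Maybe Bool
polarity []            i = nothing
polarity (lit y b ∷ c) i with y Fin.≟ i
... | yes _ = just b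
... | no  _ = polarity c i

polarity-sound : ∀ {n} (c : Clause n) {i b} → polarity c i ≡ just b → lit i b ∈ c
polarity-sound []             ()
polarity-sound (lit y b′ ∷ c) {i} eq with y Fin.≟ i
polarity-sound (lit y b′ ∷ c) refl | yes refl = here refl
... | no _ = there (polarity-sound c eq)

polarity-complete : ∀ {n} {c : Clause n} {i b} → Consistent c → lit i b ∈ c → polarity c i ≡ just b
polarity-complete {c = lit y b′ ∷ c} {i} {b} con i,b∈ with y Fin.≟ i | i,b∈
... | yes refl | here refl   = refl
... | yes refl | there i,b∈c with b′ Bool.≟ b
...   | yes refl = refl
...   | no b′≢b  =
  contradiction (here (cong (lit i) (sym (¬-not b′≢b)))) (con (lit i b) (there i,b∈c))
polarity-complete con i,b∈ | no y≢i | here refl   = contradiction refl y≢i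
polarity-complete con i,b∈ | no _   | there i,b∈c =
  polarity-complete (λ l l∈c l̄∈c → con l (there l∈c) (there l̄∈c)) i,b∈c

signPattern : ∀ {n} → Clause n → Pattern n
signPattern c = tabulate (polarity c)

signPattern-⊆ : ∀ {n} {c d : Clause n} → Consistent c → signPattern c ≡ signPattern d → c ⊆ d
signPattern-⊆ {c = c} {d} con eq {lit i b} i,b∈c = polarity-sound d (begin
  polarity d i              ≡⟨ lookup∘tabulate (polarity d) i ⟨
  lookup (signPattern d) i  ≡⟨ cong (λ v → lookup v i) eq ⟨
  lookup (signPattern c) i  ≡⟨ lookup∘tabulate (polarity c) i ⟩
  polarity c i              ≡⟨ polarity-complete con i,b∈c ⟩
  just b                    ∎)
  where open ≡-Reasoning

signPattern-injective : ∀ {n} {c d : Clause n} → Consistent c → Consistent d →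
  signPattern c ≡ signPattern d → SameSet c d
signPattern-injective con-c con-d eq = signPattern-⊆ con-c eq , signPattern-⊆ con-d (sym eq)

hits-signPattern : ∀ {n} {σ : Assignment n} {c} → Consistent c → Any (litTrue σ) c →
  hits (tabulate σ) (signPattern c) ≡ true
hits-signPattern {σ = σ} {c} con σ⊨c with find σ⊨c
... | lit i b , i,b∈c , σi≡b = hits-lookup (tabulate σ) (signPattern c) i (begin
  lookup (signPattern c) i        ≡⟨ lookup∘tabulate (polarity c) i ⟩
  polarity c i                    ≡⟨ polarity-complete con i,b∈c ⟩
  just b                          ≡⟨ cong just σi≡b ⟨
  just (σ i)                      ≡⟨ cong just (lookup∘tabulate σ i) ⟨
  just (lookup (tabulate σ) i)    ∎)
  where open ≡-Reasoning

length≤count-hitsBoth : ∀ {n} {φ : Formula n} {σ τ} → IsPCNF φ → Satisfies σ φ → Satisfies τ φ →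
  length φ ≤ count n (hitsBoth (tabulate σ) (tabulate τ))
length≤count-hitsBoth {n} {φ} {σ} {τ} (precise , distinct) σ⊨φ τ⊨φ =
  subst (_≤ count n P) (length-map signPattern φ) (Unique⇒length≤count P patterns-unique patterns-hit)
  where
  P = hitsBoth (tabulate σ) (tabulate τ)
  consistent : All Consistent φ
  consistent = All.map (proj₂ ∘ proj₂) precise
  patterns-unique : Unique (map signPattern φ)
  patterns-unique = AllPairs.map⁺ (AllPairs-map-All
    (λ con-c con-d c≁d → c≁d ∘ signPattern-injective con-c con-d) consistent distinct)
  patterns-hit : All (λ v → P v ≡ true) (map signPattern φ)
  patterns-hit = All.map⁺ (All.zipWith
    (λ (con , σ⊨c , τ⊨c) → cong₂ _∧_ (hits-signPattern con σ⊨c) (hits-signPattern con τ⊨c))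
    (consistent , All.zip (σ⊨φ , τ⊨φ)))

theorem3 : (n : ℕ) → n ≥ 1 → (φ : Formula n) → IsPCNF φ →
    length φ > g n →
    (σ τ : Assignment n) → Satisfies σ φ → Satisfies τ φ →
    (x : Fin n) → σ x ≡ τ x
theorem3 zero ()
theorem3 (suc m) _ φ pcnf |φ|>g σ τ σ⊨φ τ⊨φ x with σ x Bool.≟ τ x
... | yes σx≡τx = σx≡τx
... | no  σx≢τx = contradiction (g-bound m |φ|+3·2ᵐ≤3ⁿ) (<⇒≱ |φ|>g)
  where
  σ≢τ : tabulate σ ≢ tabulate τ
  σ≢τ eq = σx≢τx (begin
    σ x                    ≡⟨ lookup∘tabulate σ x ⟨
    lookup (tabulate σ) x  ≡⟨ cong (λ v → lookup v x) eq ⟩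
    lookup (tabulate τ) x  ≡⟨ lookup∘tabulate τ x ⟩
    τ x                    ∎)
    where open ≡-Reasoning
  |φ|+3·2ᵐ≤3ⁿ : length φ + 3 * 2 ^ m ≤ 3 ^ suc m
  |φ|+3·2ᵐ≤3ⁿ = ≤-trans (+-monoˡ-≤ (3 * 2 ^ m) (length≤count-hitsBoth pcnf σ⊨φ τ⊨φ))
                        (count-hitsBoth m (tabulate σ) (tabulate τ) σ≢τ)
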